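{- Let $\mathcal{F}$ be a finite $3$-uniform linear family and $\mathcal{M}$ a maximum matching of $\mathcal{F}$. For all distinct $A,B\in\mathcal{M}$, $|D_2(A,B)|\leq 8$.
   Context: $3$-uniform: every member has exactly $3$ elements; linear: distinct members share at most one element. A matching is a set of pairwise disjoint members; maximum means of largest size. $X_{\mathcal{M}}=\bigcup_{A\in\mathcal{M}}A$, $D_2(\mathcal{F})=\{E\in\mathcal{F}: |E\cap X_{\mathcal{M}}|=2\}$, and for $A,B\in\mathcal{M}$, $D_2(A,B)=\{C\in D_2(\mathcal{F}): C\cap A\neq\emptyset,\ C\cap B\neq\emptyset\}$. -}

module Defs where

open import Data.Nat using (ℕ; _≤_; _≟_)
open import Data.Fin.Subset using (Subset; _∩_; ∣_∣; ⋃; Nonempty; Empty)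
open import Data.Fin.Subset.Properties using (nonempty?)
open import Data.List using (List; length; filter)
open import Data.List.Membership.Propositional using (_∈_)
open import Data.List.Relation.Unary.All using (All)
open import Data.List.Relation.Unary.AllPairs using (AllPairs)
open import Data.List.Relation.Unary.Unique.Propositional using (Unique)
open import Data.Product using (_×_)
open import Relation.Binary.PropositionalEquality using (_≡_; _≢_)
open import Relation.Nullary using (Dec; yes; no)
open import Relation.Nullary.Decidable using (_×-dec_)

-- A finite family of subsets of the ground set Fin n, given as a
-- duplicate-free list (a family is a set of sets).
Family : ℕ → Set
Family n = List (Subset n)

Uniform3 : ∀ {n} → Family n → Set
Uniform3 F = All (λ E → ∣ E ∣ ≡ 3) F

Linear : ∀ {n} → Family n → Set
Linear F = ∀ {E E′} → E ∈ F → E′ ∈ F → E ≢ E′ → ∣ E ∩ E′ ∣ ≤ 1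

IsMatching : ∀ {n} → Family n → Family n → Set
IsMatching F M = Unique M × All (_∈ F) M × AllPairs (λ A B → Empty (A ∩ B)) M

IsMaximumMatching : ∀ {n} → Family n → Family n → Set
IsMaximumMatching F M =
  IsMatching F M × (∀ M′ → IsMatching F M′ → length M′ ≤ length M)

X : ∀ {n} → Family n → Subset n
X M = ⋃ M

InD2 : ∀ {n} → Family n → Subset n → Subset n → Subset n → Set
InD2 M A B C = (∣ C ∩ X M ∣ ≡ 2) × Nonempty (C ∩ A) × Nonempty (C ∩ B)

inD2? : ∀ {n} (M : Family n) (A B C : Subset n) → Dec (InD2 M A B C)
inD2? M A B C = (∣ C ∩ X M ∣ ≟ 2) ×-dec (nonempty? (C ∩ A) ×-dec nonempty? (C ∩ B))

-- D_2(A,B) as a sublist of F (F duplicate-free, so its length is |D_2(A,B)|).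
D2 : ∀ {n} → Family n → Family n → Subset n → Subset n → Family n
D2 F M A B = filter (inD2? M A B) F

-- If |D₂(A,B)| ≥ 9, then, since |C| = 3 and |C ∩ X_M| = 2, every C ∈ D₂(A,B) is {aᵢ, bⱼ, v}
-- with aᵢ ∈ A, bⱼ ∈ B and v ∉ X_M, and by linearity different members give different pairs
-- (i, j); so all nine pairs occur, and the outer vertices v(i, j) form a 3×3 array whose rows
-- and columns are injective, again by linearity. Such an array has a transversal with three
-- distinct entries. Its three members are pairwise disjoint and meet X_M only inside A ∪ B,
-- so replacing A and B by them in M gives a larger matching.

module Submission where

open import Defs
import Data.Bool.Properties as Bool
open import Data.Fin using (Fin; zero; suc; #_; combine; fromℕ<; punchOut)
open import Data.Fin.Properties
  using (_≟_; suc-injective; any?; combine-injectiveˡ; combine-injectiveʳ; punchOut-injective; injective⇒≤)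
open import Data.Fin.Subset using (Subset; inside; outside; _∩_; ∣_∣; ⋃; Nonempty; Empty; _⊆_; _-_)
  renaming (_∈_ to _∈ₛ_; _∉_ to _∉ₛ_)
open import Data.Fin.Subset.Properties
  using (x∈p∩q⁺; x∈p∩q⁻; x∈p∪q⁺; _∈?_; p⊆q⇒∣p∣≤∣q∣; x∈p⇒∣p-x∣<∣p∣; x∈p∧x≢y⇒x∈p-y)
open import Data.List using (List; []; _∷_; length; lookup; _++_)
open import Data.List.Membership.Propositional using (_∈_)
open import Data.List.Membership.Propositional.Properties using (∈-filter⁻; ∈-lookup)
open import Data.List.Relation.Unary.All as All using (All; []; _∷_)
open import Data.List.Relation.Unary.AllPairs as AllPairs using (AllPairs; []; _∷_)
import Data.List.Relation.Unary.AllPairs.Properties as AllPairs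
open import Data.List.Relation.Unary.Any using (here; there)
open import Data.List.Relation.Unary.Unique.Propositional using (Unique)
open import Data.List.Relation.Unary.Unique.Propositional.Properties using (filter⁺)
import Data.List.Relation.Binary.Permutation.Setoid as Permutation
import Data.List.Relation.Binary.Permutation.Setoid.Properties as PermutationProperties
open import Data.Nat using (ℕ; suc; _+_; _≤_; _<_; z≤n; s≤s)
open import Data.Nat.Properties using (≤-trans; ≤-refl; <-irrefl; <⇒≱; ≮⇒≥)
open import Data.Product using (∃; ∃₂; _×_; _,_; proj₁; proj₂; swap)
open import Data.Sum using (_⊎_; inj₁; inj₂)
open import Data.Vec using ([]; _∷_; here; there)
open import Data.Vec.Properties using (≡-dec)
open import Function using (_∘_)
open import Function.Definitions using (Injective)
open import Relation.Binary.Definitions using (DecidableEquality)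
open import Relation.Binary.PropositionalEquality
  using (_≡_; _≢_; refl; sym; trans; cong; subst; subst₂; resp₂; setoid; ≢-sym)
open import Relation.Nullary using (yes; no; contradiction; ¬?)
open import Relation.Nullary.Decidable using (_×-dec_; decidable-stable)

private
  variable
    n : ℕ
    p q : Subset n
    x y z w : Fin n

Disjoint : Subset n → Subset n → Set
Disjoint p q = Empty (p ∩ q)

Disjoint-sym : Disjoint p q → Disjoint q p
Disjoint-sym {p = p} {q} p∩q≡∅ (x , x∈q∩p) = p∩q≡∅ (x , x∈p∩q⁺ (swap (x∈p∩q⁻ q p x∈q∩p)))

∈∧∉⇒≢ : x ∈ₛ p → y ∉ₛ p → x ≢ y
∈∧∉⇒≢ x∈p y∉p refl = y∉p x∈p

Nonempty∧Disjoint⇒≢ : Nonempty p → Disjoint p q → p ≢ q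
Nonempty∧Disjoint⇒≢ (x , x∈p) p∩p≡∅ refl = p∩p≡∅ (x , x∈p∩q⁺ (x∈p , x∈p))

record Enumeration (k : ℕ) (p : Subset n) : Set where
  field
    elem      : Fin k → Fin n
    elem∈     : ∀ i → elem i ∈ₛ p
    injective : Injective _≡_ _≡_ elem
    covers    : x ∈ₛ p → ∃ λ i → elem i ≡ x

enumerate : (p : Subset n) → Enumeration ∣ p ∣ p
enumerate [] = record { elem = λ () ; elem∈ = λ () ; injective = λ { {()} } ; covers = λ () }
enumerate (outside ∷ p) = record
  { elem      = suc ∘ elem
  ; elem∈     = λ i → there (elem∈ i)
  ; injective = injective ∘ suc-injective
  ; covers    = λ { (there x∈p) → let i , eq = covers x∈p in i , cong suc eq }
  }
  where open Enumeration (enumerate p)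
enumerate (inside ∷ p) = record
  { elem = elem′ ; elem∈ = elem′∈ ; injective = elem′-injective ; covers = elem′-covers }
  where
  open Enumeration (enumerate p)
  elem′ : Fin (suc ∣ p ∣) → Fin (suc _)
  elem′ zero    = zero
  elem′ (suc i) = suc (elem i)
  elem′∈ : ∀ i → elem′ i ∈ₛ inside ∷ p
  elem′∈ zero    = here
  elem′∈ (suc i) = there (elem∈ i)
  elem′-injective : Injective _≡_ _≡_ elem′
  elem′-injective {zero}  {zero}  _  = refl
  elem′-injective {zero}  {suc _} ()
  elem′-injective {suc _} {zero}  ()
  elem′-injective {suc i} {suc j} eq = cong suc (injective (suc-injective eq))
  elem′-covers : x ∈ₛ inside ∷ p → ∃ λ i → elem′ i ≡ x
  elem′-covers here          = zero , refl
  elem′-covers (there x∈p) = let i , eq = covers x∈p in suc i , cong suc eq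

0<∣p∣⇒Nonempty : 0 < ∣ p ∣ → Nonempty p
0<∣p∣⇒Nonempty {p = p} 0<∣p∣ = elem (fromℕ< 0<∣p∣) , elem∈ _
  where open Enumeration (enumerate p)

Unique⇒length≤∣p∣ : {xs : List (Fin n)} → Unique xs → All (_∈ₛ p) xs → length xs ≤ ∣ p ∣
Unique⇒length≤∣p∣ [] [] = z≤n
Unique⇒length≤∣p∣ {p = p} {x ∷ _} (x∉xs ∷ xs-unique) (x∈p ∷ xs⊆p) =
  ≤-trans (s≤s (Unique⇒length≤∣p∣ xs-unique (All.zipWith move (x∉xs , xs⊆p)))) (x∈p⇒∣p-x∣<∣p∣ x∈p)
  where
  move : x ≢ y × y ∈ₛ p → y ∈ₛ p - x
  move (x≢y , y∈p) = x∈p∧x≢y⇒x∈p-y y∈p (≢-sym x≢y)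

∣p∩q∣<∣p∣⇒∃∉ : (p q : Subset n) → ∣ p ∩ q ∣ < ∣ p ∣ → ∃ λ x → x ∈ₛ p × x ∉ₛ q
∣p∩q∣<∣p∣⇒∃∉ p q ∣p∩q∣<∣p∣ with any? (λ x → x ∈? p ×-dec ¬? (x ∈? q))
... | yes found = found
... | no none = contradiction (p⊆q⇒∣p∣≤∣q∣ p⊆p∩q) (<⇒≱ ∣p∩q∣<∣p∣)
  where
  p⊆p∩q : p ⊆ p ∩ q
  p⊆p∩q {x} x∈p = x∈p∩q⁺ (x∈p , decidable-stable (x ∈? q) λ x∉q → none (x , x∈p , x∉q))

∣p∣≡3⇒one-of : ∣ p ∣ ≡ 3 → x ≢ y → x ≢ z → y ≢ z → x ∈ₛ p → y ∈ₛ p → z ∈ₛ p →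
               w ∈ₛ p → w ≡ x ⊎ w ≡ y ⊎ w ≡ z
∣p∣≡3⇒one-of {p = p} {x = x} {y} {z} {w} ∣p∣≡3 x≢y x≢z y≢z x∈p y∈p z∈p w∈p
  with w ≟ x | w ≟ y | w ≟ z
... | yes w≡x | _ | _ = inj₁ w≡x
... | no _ | yes w≡y | _ = inj₂ (inj₁ w≡y)
... | no _ | no _ | yes w≡z = inj₂ (inj₂ w≡z)
... | no w≢x | no w≢y | no w≢z = contradiction (subst (4 ≤_) ∣p∣≡3 4≤∣p∣) (<-irrefl refl)
  where
  4≤∣p∣ : 4 ≤ ∣ p ∣
  4≤∣p∣ = Unique⇒length≤∣p∣
    ((x≢y ∷ x≢z ∷ ≢-sym w≢x ∷ []) ∷ (y≢z ∷ ≢-sym w≢y ∷ []) ∷ (≢-sym w≢z ∷ []) ∷ [] ∷ [])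
    (x∈p ∷ y∈p ∷ z∈p ∷ w∈p ∷ [])

shared-pair⇒≡ : {F : Family n} {C C′ : Subset n} → Linear F → C ∈ F → C′ ∈ F →
                x ≢ y → x ∈ₛ C → y ∈ₛ C → x ∈ₛ C′ → y ∈ₛ C′ → C ≡ C′
shared-pair⇒≡ {C = C} {C′} F-linear C∈F C′∈F x≢y x∈C y∈C x∈C′ y∈C′ with ≡-dec Bool._≟_ C C′
... | yes C≡C′ = C≡C′
... | no C≢C′ = contradiction (≤-trans 2≤∣C∩C′∣ (F-linear C∈F C′∈F C≢C′)) (<-irrefl refl)
  where
  2≤∣C∩C′∣ : 2 ≤ ∣ C ∩ C′ ∣
  2≤∣C∩C′∣ = Unique⇒length≤∣p∣ ((x≢y ∷ []) ∷ [] ∷ []) (x∈p∩q⁺ (x∈C , x∈C′) ∷ x∈p∩q⁺ (y∈C , y∈C′) ∷ [])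

∈⋃ : {D : Subset n} (M : Family n) → D ∈ M → x ∈ₛ D → x ∈ₛ ⋃ M
∈⋃ (D ∷ M) (here refl) x∈D = x∈p∪q⁺ (inj₁ x∈D)
∈⋃ (_ ∷ M) (there D∈M) x∈D = x∈p∪q⁺ (inj₂ (∈⋃ M D∈M x∈D))

module _ {A : Set} where

  open Permutation (setoid A) using (_↭_; ↭-trans; ↭-prep; ↭-swap; ↭-refl)
  open PermutationProperties (setoid A) using (∈-resp-↭)

  Unique⇒lookup-injective : {xs : List A} → Unique xs → Injective _≡_ _≡_ (lookup xs)
  Unique⇒lookup-injective {_ ∷ _} _ {zero} {zero} _ = refl
  Unique⇒lookup-injective {_ ∷ _} (x∉xs ∷ _) {zero} {suc j} x≡xⱼ = contradiction x≡xⱼ (All.lookup x∉xs (∈-lookup j))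
  Unique⇒lookup-injective {_ ∷ _} (x∉xs ∷ _) {suc i} {zero} xᵢ≡x = contradiction (sym xᵢ≡x) (All.lookup x∉xs (∈-lookup i))
  Unique⇒lookup-injective {_ ∷ _} (_ ∷ xs-unique) {suc i} {suc j} xᵢ≡xⱼ =
    cong suc (Unique⇒lookup-injective xs-unique xᵢ≡xⱼ)

  ∈⇒↭∷ : {a : A} {xs : List A} → a ∈ xs → ∃ λ ys → xs ↭ a ∷ ys
  ∈⇒↭∷ (here refl) = _ , ↭-refl
  ∈⇒↭∷ {a} {x ∷ _} (there a∈xs) = let ys , xs↭a∷ys = ∈⇒↭∷ a∈xs in
    x ∷ ys , ↭-trans (↭-prep x xs↭a∷ys) (↭-swap x a ↭-refl)

  ∈∧∈⇒↭∷∷ : {a b : A} {xs : List A} → a ∈ xs → b ∈ xs → a ≢ b → ∃ λ zs → xs ↭ a ∷ b ∷ zs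
  ∈∧∈⇒↭∷∷ {a} {b} a∈xs b∈xs a≢b with ys , xs↭a∷ys ← ∈⇒↭∷ a∈xs
    with ∈-resp-↭ xs↭a∷ys b∈xs
  ... | here b≡a = contradiction (sym b≡a) a≢b
  ... | there b∈ys with zs , ys↭b∷zs ← ∈⇒↭∷ b∈ys = zs , ↭-trans xs↭a∷ys (↭-prep a ys↭b∷zs)

injective⇒onto : {m n : ℕ} {f : Fin m → Fin n} → Injective _≡_ _≡_ f → n ≤ m → ∀ t → ∃ λ i → f i ≡ t
injective⇒onto {n = suc _} {f = f} f-injective n≤m t with any? (λ i → f i ≟ t)
... | yes hit = hit
... | no miss = contradiction (injective⇒≤ f′-injective) (<⇒≱ n≤m)
  where
  f≢t : ∀ i → t ≢ f i
  f≢t i t≡fi = miss (i , sym t≡fi)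
  f′-injective : Injective _≡_ _≡_ (λ i → punchOut (f≢t i))
  f′-injective {i} {j} eq = f-injective (punchOut-injective (f≢t i) (f≢t j) eq)

module _ {X : Set} (s : Fin 3 → Fin 3 → X) where

  Separated : Fin 3 × Fin 3 → Fin 3 × Fin 3 → Set
  Separated (i , j) (i′ , j′) = i ≢ i′ × j ≢ j′ × s i j ≢ s i′ j′

  record RainbowTransversal : Set where
    field
      cell₁ cell₂ cell₃ : Fin 3 × Fin 3
      separated₁₂ : Separated cell₁ cell₂
      separated₁₃ : Separated cell₁ cell₃
      separated₂₃ : Separated cell₂ cell₃

  module _ (_≟ₓ_ : DecidableEquality X)
           (row-injective : ∀ i → Injective _≡_ _≡_ (s i))
           (column-injective : ∀ j → Injective _≡_ _≡_ (λ i → s i j)) where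

    repeat⇒RainbowTransversal : {p q r : Fin 3} → p ≢ q → p ≢ r → q ≢ r →
                                s p p ≡ s q q → RainbowTransversal
    repeat⇒RainbowTransversal {p} {q} {r} p≢q p≢r q≢r spp≡sqq with s q r ≟ₓ s r q
    ... | no sqr≢srq = record
      { cell₁ = p , p ; cell₂ = q , r ; cell₃ = r , q
      ; separated₁₂ = p≢q , p≢r , λ spp≡sqr → q≢r (row-injective q (trans (sym spp≡sqq) spp≡sqr))
      ; separated₁₃ = p≢r , p≢q , λ spp≡srq → q≢r (column-injective q (trans (sym spp≡sqq) spp≡srq))
      ; separated₂₃ = q≢r , ≢-sym q≢r , sqr≢srq
      }
    ... | yes sqr≡srq with s p r ≟ₓ s r p
    ...   | no spr≢srp = record
      { cell₁ = r , p ; cell₂ = q , q ; cell₃ = p , r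
      ; separated₁₂ = ≢-sym q≢r , p≢q , λ srp≡sqq → p≢r (sym (column-injective p (trans srp≡sqq (sym spp≡sqq))))
      ; separated₁₃ = ≢-sym p≢r , p≢r , spr≢srp ∘ sym
      ; separated₂₃ = ≢-sym p≢q , q≢r , λ sqq≡spr → p≢r (row-injective p (trans spp≡sqq sqq≡spr))
      }
    ...   | yes spr≡srp = record
      { cell₁ = p , q ; cell₂ = q , r ; cell₃ = r , p
      ; separated₁₂ = p≢q , q≢r , λ spq≡sqr → p≢r (column-injective q (trans spq≡sqr sqr≡srq))
      ; separated₁₃ = p≢r , ≢-sym p≢q , λ spq≡srp → q≢r (row-injective p (trans spq≡srp (sym spr≡srp)))
      ; separated₂₃ = q≢r , ≢-sym p≢r , λ sqr≡srp → p≢q (sym (row-injective r (trans (sym sqr≡srq) sqr≡srp)))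
      }

    rainbowTransversal : RainbowTransversal
    rainbowTransversal with s (# 0) (# 0) ≟ₓ s (# 1) (# 1) | s (# 0) (# 0) ≟ₓ s (# 2) (# 2)
                          | s (# 1) (# 1) ≟ₓ s (# 2) (# 2)
    ... | yes s₀₀≡s₁₁ | _ | _ = repeat⇒RainbowTransversal {# 0} {# 1} {# 2} (λ ()) (λ ()) (λ ()) s₀₀≡s₁₁
    ... | _ | yes s₀₀≡s₂₂ | _ = repeat⇒RainbowTransversal {# 0} {# 2} {# 1} (λ ()) (λ ()) (λ ()) s₀₀≡s₂₂
    ... | _ | _ | yes s₁₁≡s₂₂ = repeat⇒RainbowTransversal {# 1} {# 2} {# 0} (λ ()) (λ ()) (λ ()) s₁₁≡s₂₂
    ... | no s₀₀≢s₁₁ | no s₀₀≢s₂₂ | no s₁₁≢s₂₂ = record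
      { cell₁ = # 0 , # 0 ; cell₂ = # 1 , # 1 ; cell₃ = # 2 , # 2
      ; separated₁₂ = (λ ()) , (λ ()) , s₀₀≢s₁₁
      ; separated₁₃ = (λ ()) , (λ ()) , s₀₀≢s₂₂
      ; separated₂₃ = (λ ()) , (λ ()) , s₁₁≢s₂₂
      }

Disjoint∧Nonempty⇒Unique : {xs : Family n} → All Nonempty xs → AllPairs Disjoint xs → Unique xs
Disjoint∧Nonempty⇒Unique [] [] = []
Disjoint∧Nonempty⇒Unique (x-nonempty ∷ xs-nonempty) (x-disjoint ∷ xs-disjoint) =
  All.map (Nonempty∧Disjoint⇒≢ x-nonempty) x-disjoint ∷ Disjoint∧Nonempty⇒Unique xs-nonempty xs-disjoint

Disjoint⇒IsMatching : {F M : Family n} → (∀ {E} → E ∈ F → Nonempty E) →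
                      All (_∈ F) M → AllPairs Disjoint M → IsMatching F M
Disjoint⇒IsMatching F-nonempty M⊆F M-disjoint =
  Disjoint∧Nonempty⇒Unique (All.map F-nonempty M⊆F) M-disjoint , M⊆F , M-disjoint

module _ {F M : Family n} (F-uniform : Uniform3 F) (F-linear : Linear F) (M-matching : IsMatching F M)
         {A B : Subset n} (A∈M : A ∈ M) (B∈M : B ∈ M) (A≢B : A ≢ B) where

  open Permutation (setoid (Subset n)) using (_↭_; ↭-sym)
  open PermutationProperties (setoid (Subset n)) using (AllPairs-resp-↭; ∈-resp-↭; xs↭ys⇒|xs|≡|ys|)

  R : Family n
  R = proj₁ (∈∧∈⇒↭∷∷ A∈M B∈M A≢B)

  M↭A∷B∷R : M ↭ A ∷ B ∷ R
  M↭A∷B∷R = proj₂ (∈∧∈⇒↭∷∷ A∈M B∈M A≢B)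

  M⊆F : All (_∈ F) M
  M⊆F = proj₁ (proj₂ M-matching)

  A∷B∷R-disjoint : AllPairs Disjoint (A ∷ B ∷ R)
  A∷B∷R-disjoint = AllPairs-resp-↭ Disjoint-sym (resp₂ Disjoint) M↭A∷B∷R (proj₂ (proj₂ M-matching))

  R⊆M : ∀ {D} → D ∈ R → D ∈ M
  R⊆M D∈R = ∈-resp-↭ (↭-sym M↭A∷B∷R) (there (there D∈R))

  F-nonempty : ∀ {E} → E ∈ F → Nonempty E
  F-nonempty E∈F = 0<∣p∣⇒Nonempty (subst (0 <_) (sym (All.lookup F-uniform E∈F)) (s≤s z≤n))

  triple : ∀ {E} → E ∈ M → Enumeration 3 E
  triple {E} E∈M = subst (λ k → Enumeration k E) (All.lookup F-uniform (All.lookup M⊆F E∈M)) (enumerate E)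

  open Enumeration (triple A∈M) renaming (elem to a; elem∈ to a∈A; injective to a-injective; covers to A-covers)
  open Enumeration (triple B∈M) renaming (elem to b; elem∈ to b∈B; injective to b-injective; covers to B-covers)

  a∈X : ∀ i → a i ∈ₛ X M
  a∈X i = ∈⋃ M A∈M (a∈A i)

  b∈X : ∀ j → b j ∈ₛ X M
  b∈X j = ∈⋃ M B∈M (b∈B j)

  a≢b : ∀ i j → a i ≢ b j
  a≢b i j aᵢ≡bⱼ with (A∩B≡∅ ∷ _) ∷ _ ← A∷B∷R-disjoint =
    A∩B≡∅ (a i , x∈p∩q⁺ (a∈A i , subst (_∈ₛ B) (sym aᵢ≡bⱼ) (b∈B j)))

  record CrossEdge (i j : Fin 3) (C : Subset n) : Set where
    field
      C∈F     : C ∈ F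
      apex    : Fin n
      apex∉X  : apex ∉ₛ X M
      a∈C     : a i ∈ₛ C
      b∈C     : b j ∈ₛ C
      apex∈C  : apex ∈ₛ C
      one-of  : z ∈ₛ C → z ≡ a i ⊎ z ≡ b j ⊎ z ≡ apex

  -- Opaque because only its statement matters, and unfolding it makes checking `grid` very slow.
  opaque
    D2⇒CrossEdge : ∀ {C} → C ∈ D2 F M A B → ∃₂ λ i j → CrossEdge i j C
    D2⇒CrossEdge {C} C∈D2
      with C∈F , ∣C∩X∣≡2 , (_ , α∈C∩A) , (_ , β∈C∩B) ← ∈-filter⁻ (inD2? M A B) C∈D2
      with α∈C , α∈A ← x∈p∩q⁻ C A α∈C∩A | β∈C , β∈B ← x∈p∩q⁻ C B β∈C∩B
      with i , refl ← A-covers α∈A | j , refl ← B-covers β∈B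
      with v , v∈C , v∉X ← ∣p∩q∣<∣p∣⇒∃∉ C (X M)
             (subst₂ _<_ (sym ∣C∩X∣≡2) (sym (All.lookup F-uniform C∈F)) ≤-refl)
      = i , j , record
      { C∈F = C∈F ; apex = v ; apex∉X = v∉X ; a∈C = α∈C ; b∈C = β∈C ; apex∈C = v∈C
      ; one-of = ∣p∣≡3⇒one-of (All.lookup F-uniform C∈F) (a≢b i j) (∈∧∉⇒≢ (a∈X i) v∉X)
                   (∈∧∉⇒≢ (b∈X j) v∉X) α∈C β∈C v∈C
      }

  module _ {i j C} (E : CrossEdge i j C) where
    open CrossEdge E

    ∈A⇒≡a : z ∈ₛ C → z ∈ₛ A → z ≡ a i
    ∈A⇒≡a z∈C z∈A with one-of z∈C
    ... | inj₁ z≡aᵢ = z≡aᵢ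
    ... | inj₂ (inj₁ z≡bⱼ) = let i′ , aᵢ′≡z = A-covers z∈A in contradiction (trans aᵢ′≡z z≡bⱼ) (a≢b i′ j)
    ... | inj₂ (inj₂ refl) = contradiction (∈⋃ M A∈M z∈A) apex∉X

    ∈B⇒≡b : z ∈ₛ C → z ∈ₛ B → z ≡ b j
    ∈B⇒≡b z∈C z∈B with one-of z∈C
    ... | inj₁ z≡aᵢ = let j′ , bⱼ′≡z = B-covers z∈B in contradiction (trans (sym z≡aᵢ) (sym bⱼ′≡z)) (a≢b i j′)
    ... | inj₂ (inj₁ z≡bⱼ) = z≡bⱼ
    ... | inj₂ (inj₂ refl) = contradiction (∈⋃ M B∈M z∈B) apex∉X

    ∉X⇒≡apex : z ∈ₛ C → z ∉ₛ X M → z ≡ apex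
    ∉X⇒≡apex z∈C z∉X with one-of z∈C
    ... | inj₁ refl = contradiction (a∈X i) z∉X
    ... | inj₂ (inj₁ refl) = contradiction (b∈X j) z∉X
    ... | inj₂ (inj₂ z≡apex) = z≡apex

    CrossEdge⇒Disjoint-R : All (Disjoint C) R
    CrossEdge⇒Disjoint-R with (_ ∷ A-R) ∷ B-R ∷ _ ← A∷B∷R-disjoint = All.tabulate disjoint
      where
      disjoint : ∀ {D} → D ∈ R → Disjoint C D
      disjoint {D} D∈R (z , z∈C∩D) with z∈C , z∈D ← x∈p∩q⁻ C D z∈C∩D with one-of z∈C
      ... | inj₁ refl = All.lookup A-R D∈R (z , x∈p∩q⁺ (a∈A i , z∈D))
      ... | inj₂ (inj₁ refl) = All.lookup B-R D∈R (z , x∈p∩q⁺ (b∈B j , z∈D))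
      ... | inj₂ (inj₂ refl) = apex∉X (∈⋃ M (R⊆M D∈R) z∈D)

  open CrossEdge

  module _ {i j i′ j′ C C′} (E : CrossEdge i j C) (E′ : CrossEdge i′ j′ C′) where

    same-cell⇒≡ : i ≡ i′ → j ≡ j′ → C ≡ C′
    same-cell⇒≡ refl refl =
      shared-pair⇒≡ F-linear (C∈F E) (C∈F E′) (a≢b i j) (a∈C E) (b∈C E) (a∈C E′) (b∈C E′)

    same-row-apex⇒same-column : i ≡ i′ → apex E ≡ apex E′ → j ≡ j′
    same-row-apex⇒same-column refl apex≡apex′
      with refl ← shared-pair⇒≡ F-linear (C∈F E′) (C∈F E) (∈∧∉⇒≢ (a∈X i) (apex∉X E′))
                    (a∈C E′) (apex∈C E′) (a∈C E) (subst (_∈ₛ C) apex≡apex′ (apex∈C E))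
      = sym (b-injective (∈B⇒≡b E (b∈C E′) (b∈B j′)))

    same-column-apex⇒same-row : j ≡ j′ → apex E ≡ apex E′ → i ≡ i′
    same-column-apex⇒same-row refl apex≡apex′
      with refl ← shared-pair⇒≡ F-linear (C∈F E′) (C∈F E) (∈∧∉⇒≢ (b∈X j) (apex∉X E′))
                    (b∈C E′) (apex∈C E′) (b∈C E) (subst (_∈ₛ C) apex≡apex′ (apex∈C E))
      = sym (a-injective (∈A⇒≡a E (a∈C E′) (a∈A i′)))

    separated⇒Disjoint : i ≢ i′ → j ≢ j′ → apex E ≢ apex E′ → Disjoint C C′
    separated⇒Disjoint i≢i′ j≢j′ apex≢apex′ (z , z∈C∩C′)
      with z∈C , z∈C′ ← x∈p∩q⁻ C C′ z∈C∩C′ with one-of E z∈C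
    ... | inj₁ refl = i≢i′ (a-injective (∈A⇒≡a E′ z∈C′ (a∈A i)))
    ... | inj₂ (inj₁ refl) = j≢j′ (b-injective (∈B⇒≡b E′ z∈C′ (b∈B j)))
    ... | inj₂ (inj₂ refl) = apex≢apex′ (∉X⇒≡apex E′ z∈C′ (apex∉X E))

  L : Family n
  L = D2 F M A B

  module _ (L-unique : Unique L) where

    cell : Fin (length L) → Fin 9
    cell k = let i , j , _ = D2⇒CrossEdge (∈-lookup k) in combine i j

    cell-injective : Injective _≡_ _≡_ cell
    cell-injective {k} {k′} cₖ≡cₖ′ =
      let i , j , E = D2⇒CrossEdge (∈-lookup k)
          i′ , j′ , E′ = D2⇒CrossEdge (∈-lookup k′)
      in Unique⇒lookup-injective L-unique
           (same-cell⇒≡ E E′ (combine-injectiveˡ i j i′ j′ cₖ≡cₖ′) (combine-injectiveʳ i j i′ j′ cₖ≡cₖ′))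

    grid : 9 ≤ length L → ∀ i j → ∃ (CrossEdge i j)
    grid 9≤∣L∣ i j =
      let k , cₖ≡ij = injective⇒onto cell-injective 9≤∣L∣ (combine i j)
          i′ , j′ , E = D2⇒CrossEdge (∈-lookup k)
      in subst₂ (λ i j → ∃ (CrossEdge i j))
           (combine-injectiveˡ i′ j′ i j cₖ≡ij) (combine-injectiveʳ i′ j′ i j cₖ≡ij) (_ , E)

    larger-matching : 9 ≤ length L → ∃ λ M′ → IsMatching F M′ × length M < length M′
    larger-matching 9≤∣L∣ = (C₁ ∷ C₂ ∷ C₃ ∷ []) ++ R , M′-matching , ∣M∣<∣M′∣
      where
      apexes : Fin 3 → Fin 3 → Fin n
      apexes i j = apex (proj₂ (grid 9≤∣L∣ i j))

      apexes-row-injective : ∀ i → Injective _≡_ _≡_ (apexes i)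
      apexes-row-injective i {j} {j′} =
        same-row-apex⇒same-column (proj₂ (grid 9≤∣L∣ i j)) (proj₂ (grid 9≤∣L∣ i j′)) refl

      apexes-column-injective : ∀ j → Injective _≡_ _≡_ (λ i → apexes i j)
      apexes-column-injective j {i} {i′} =
        same-column-apex⇒same-row (proj₂ (grid 9≤∣L∣ i j)) (proj₂ (grid 9≤∣L∣ i′ j)) refl

      open RainbowTransversal (rainbowTransversal apexes _≟_ apexes-row-injective apexes-column-injective)

      member : Fin 3 × Fin 3 → Subset n
      member (i , j) = proj₁ (grid 9≤∣L∣ i j)

      member-edge : ∀ c → CrossEdge (proj₁ c) (proj₂ c) (member c)
      member-edge (i , j) = proj₂ (grid 9≤∣L∣ i j)

      C₁ C₂ C₃ : Subset n
      C₁ = member cell₁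
      C₂ = member cell₂
      C₃ = member cell₃

      Separated⇒Disjoint : ∀ c c′ → Separated apexes c c′ → Disjoint (member c) (member c′)
      Separated⇒Disjoint (i , j) (i′ , j′) (i≢i′ , j≢j′ , apex≢apex′) =
        separated⇒Disjoint (member-edge (i , j)) (member-edge (i′ , j′)) i≢i′ j≢j′ apex≢apex′

      C₁₂₃-disjoint : AllPairs Disjoint (C₁ ∷ C₂ ∷ C₃ ∷ [])
      C₁₂₃-disjoint = (Separated⇒Disjoint cell₁ cell₂ separated₁₂ ∷ Separated⇒Disjoint cell₁ cell₃ separated₁₃ ∷ [])
                   ∷ (Separated⇒Disjoint cell₂ cell₃ separated₂₃ ∷ []) ∷ [] ∷ []

      C₁₂₃-Disjoint-R : All (λ C → All (Disjoint C) R) (C₁ ∷ C₂ ∷ C₃ ∷ [])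
      C₁₂₃-Disjoint-R = CrossEdge⇒Disjoint-R (member-edge cell₁) ∷ CrossEdge⇒Disjoint-R (member-edge cell₂)
                     ∷ CrossEdge⇒Disjoint-R (member-edge cell₃) ∷ []

      M′-matching : IsMatching F ((C₁ ∷ C₂ ∷ C₃ ∷ []) ++ R)
      M′-matching = Disjoint⇒IsMatching F-nonempty
        (C∈F (member-edge cell₁) ∷ C∈F (member-edge cell₂) ∷ C∈F (member-edge cell₃)
          ∷ All.tabulate (All.lookup M⊆F ∘ R⊆M))
        (AllPairs.++⁺ C₁₂₃-disjoint (AllPairs.tail (AllPairs.tail A∷B∷R-disjoint)) C₁₂₃-Disjoint-R)

      ∣M∣<∣M′∣ : length M < 3 + length R
      ∣M∣<∣M′∣ = subst (_< 3 + length R) (sym (xs↭ys⇒|xs|≡|ys| M↭A∷B∷R)) ≤-refl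

proposition3 : (n : ℕ) (F M : Family n) → Unique F → Uniform3 F → Linear F →
    IsMaximumMatching F M → (A B : Subset n) → A ∈ M → B ∈ M → A ≢ B →
    length (D2 F M A B) ≤ 8
proposition3 n F M F-unique F-uniform F-linear (M-matching , M-maximum) A B A∈M B∈M A≢B =
  ≮⇒≥ λ 8<∣D2∣ →
    let M′ , M′-matching , ∣M∣<∣M′∣ = larger-matching F-uniform F-linear M-matching A∈M B∈M A≢B
                                        (filter⁺ (inD2? M A B) F-unique) 8<∣D2∣
    in <⇒≱ ∣M∣<∣M′∣ (M-maximum M′ M′-matching)
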